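{- For any game with activeness $G^g$: (i) $\mathcal{G}^{\bm{1}}(G^g)=\{\mathrm{mex}\bigcup_{G'^{g'}\in G^g}\mathcal{G}^{\bm{1}}(G'^{g'})\}$. (ii) $\mathcal{G}^{\bm{0}}(G^g)=\mathbb{Z}_{\ge0}$ if $\mathrm{type}(G^g)=0$; $\mathcal{G}^{\bm{0}}(G^g)=\emptyset$ if $\mathrm{type}(G^g)=1_{\exists0}$; and $\mathcal{G}^{\bm{0}}(G^g)=\{\mathrm{mex}\bigcup_{G'^{g'}\in G^g,\ \mathrm{type}(G'^{g'})=1_{\forall1}}\mathcal{G}^{\bm{0}}(G'^{g'})\}$ if $\mathrm{type}(G^g)=1_{\forall1}$.
   Context: Let $\mathcal{B}=\{0,1\}$. Define $\mathbb{I}_0=\{\emptyset\}\times\mathcal{B}$ and $\mathbb{I}_n=2^{\mathbb{I}_{n-1}}\times\mathcal{B}$ for $n\ge1$; a game with activeness is an element of $\mathbb{I}=\bigcup_{n\ge0}\mathbb{I}_n$. A pair $(G,g)$ is written $G^g$; elements of $G$ are its options, $g=1$ meaning active. The outcome $o$ is defined recursively: $o(G^g)=\mathscr{N}$ if $g=1$ and some option has outcome $\mathscr{P}$, and $o(G^g)=\mathscr{P}$ otherwise. The sum is $G^g+H^h=(\{G'^{g'}+H^h:G'^{g'}\in G^g\}\cup\{G^g+H'^{h'}:H'^{h'}\in H^h\})^{\max\{g,h\}}$. For $\bm{\gamma}\in\mathcal{B}^\infty$, ${\ast}^{\bm{\gamma}}i=\{{\ast}^{\bm{\gamma}}j:0\le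 j<i\}^{\gamma_i}$ recursively, and $\mathcal{G}^{\bm{\gamma}}(G^g)=\{n\in\mathbb{Z}_{\ge0}:o(G^g+{\ast}^{\bm{\gamma}}n)=\mathscr{P}\}$; $\bm{0}=(0,0,\ldots)$, $\bm{1}=(1,1,\ldots)$. $\mathrm{mex}\,S=\min(\mathbb{Z}_{\ge0}\setminus S)$. $\mathrm{type}(G^g)$ is $0$ if $g=0$; $1_{\exists0}$ if $g=1$ and some option $G'^{g'}$ has $g'=0$; $1_{\forall1}$ if $g=1$ and every option has activeness $1$. -}

module Defs where

open import Data.Bool using (Bool; true; false; _∨_)
open import Data.Nat using (ℕ; zero; suc; _<_)
open import Data.List using (List; []; _∷_; _++_; _∷ʳ_)
open import Data.List.Membership.Propositional using (_∈_)
open import Data.Product using (Σ; _×_; ∃-syntax)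
open import Relation.Nullary using (¬_)

-- Finite sets of options are
-- represented by lists (duplicates/order are irrelevant to all notions below).
data Game : Set where
  mk : List Game → Bool → Game

options : Game → List Game
options (mk Gs _) = Gs

activeness : Game → Bool
activeness (mk _ g) = g

data Outcome : Set where
  𝒩 𝒫 : Outcome

mutual
  o : Game → Outcome
  o (mk Gs false) = 𝒫
  o (mk Gs true)  = someP Gs

  someP : List Game → Outcome
  someP []       = 𝒫
  someP (G ∷ Gs) = step (o G) (someP Gs)

  step : Outcome → Outcome → Outcome
  step 𝒫 _ = 𝒩
  step 𝒩 r = r

mutual
  infixl 6 _⊕_
  _⊕_ : Game → Game → Game
  mk Gs g ⊕ mk Hs h = mk (leftMoves Gs (mk Hs h) ++ rightMoves (mk Gs g) Hs) (g ∨ h)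

  leftMoves : List Game → Game → List Game
  leftMoves []        H = []
  leftMoves (G' ∷ Gs) H = (G' ⊕ H) ∷ leftMoves Gs H

  rightMoves : Game → List Game → List Game
  rightMoves G []        = []
  rightMoves G (H' ∷ Hs) = (G ⊕ H') ∷ rightMoves G Hs

Seq : Set
Seq = ℕ → Bool

𝟎 : Seq
𝟎 _ = false

𝟏 : Seq
𝟏 _ = true

mutual
  star : Seq → ℕ → Game
  star γ n = mk (starOpts γ n) (γ n)

  starOpts : Seq → ℕ → List Game
  starOpts γ zero    = []
  starOpts γ (suc n) = starOpts γ n ∷ʳ star γ n

𝒢 : Seq → Game → ℕ → Set
𝒢 γ G n = o (G ⊕ star γ n) ≡ 𝒫
  where open import Relation.Binary.PropositionalEquality using (_≡_)

IsMex : (ℕ → Set) → ℕ → Set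
IsMex S m = ¬ S m × (∀ k → k < m → S k)

data GType : Set where
  t0 t1∃0 t1∀1 : GType

mutual
  type : Game → GType
  type (mk Gs false) = t0
  type (mk Gs true)  = allActive Gs

  allActive : List Game → GType
  allActive []              = t1∀1
  allActive (mk _ false ∷ Gs) = t1∃0
  allActive (mk _ true ∷ Gs)  = allActive Gs

UnionOpts1 : Game → ℕ → Set
UnionOpts1 G k = ∃[ G' ] (G' ∈ options G × 𝒢 𝟏 G' k)

UnionOpts0 : Game → ℕ → Set
UnionOpts0 G k = ∃[ G' ] (G' ∈ options G × type G' ≡ t1∀1 × 𝒢 𝟎 G' k)
  where open import Relation.Binary.PropositionalEquality using (_≡_)

-- When G^g + ∗^γ n is active, it is a 𝒫-position exactly when every option is an
-- 𝒩-position: n lies in no 𝒢^γ(G') for an option G', and no j < n lies in 𝒢^γ(G^g).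
-- Any set T ⊆ ℕ with "n ∈ T ⇔ n ∉ S and T ∩ [0, n) = ∅" is {mex S}, and mex S exists
-- because S is a decidable finite union of sets that are at most singletons
-- (by induction on the game).  For γ = 𝟏 the sum is always active; for γ = 𝟎 it is
-- active iff g = 1, an inactive option makes G^g + ∗^𝟎 n an 𝒩-position, and options of
-- type 1_{∃0} contribute nothing to the union since their 𝒢^𝟎 is empty.
module Submission where

open import Defs
open import Data.Nat using (ℕ; zero; suc; _<_; _⊔_; s≤s)
open import Data.Nat.Properties using (<-cmp; <-irrefl; ≤-reflexive; m<1+n⇒m<n∨m≡n; m≤m⊔n; m≤n⊔m; <-≤-trans)
open import Data.Bool using (true; false; _∨_)
open import Data.Bool.Properties using (∨-zeroʳ)
open import Data.List using (List; []; _∷_; _∷ʳ_; map; applyUpTo)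
open import Data.List.Properties using (applyUpTo-∷ʳ)
open import Data.List.Membership.Propositional using (_∈_; find; lose)
open import Data.List.Relation.Unary.Any using (here; there; any?)
open import Data.List.Relation.Unary.All as All using (All; []; _∷_)
open import Data.List.Relation.Unary.All.Properties using (map⁺; map⁻; ++↔; applyUpTo⁺₁; applyUpTo⁻)
open import Data.Product using (_×_; _,_; proj₁; proj₂; ∃-syntax; uncurry)
open import Data.Product.Function.NonDependent.Propositional using (_×-⇔_)
open import Data.Sum using (_⊎_; inj₁; inj₂; [_,_]′)
open import Function using (_∘′_)
open import Function.Bundles using (_⇔_; mk⇔; Equivalence)
open import Function.Properties.Inverse using (↔⇒⇔)
open import Function.Properties.Equivalence using () renaming (refl to ⇔-refl; sym to ⇔-sym; trans to ⇔-trans)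
open import Relation.Binary using (tri<; tri≈; tri>)
open import Relation.Binary.PropositionalEquality using (_≡_; refl; sym; cong; trans)
open import Relation.Nullary using (¬_; Dec; yes; no; contradiction)
open import Relation.Nullary.Decidable using (map′; _×-dec_)

open Equivalence using (to; from)

Bounded : (ℕ → Set) → Set
Bounded S = ∃[ B ] (∀ n → S n → n < B)

MexEquation : (ℕ → Set) → (ℕ → Set) → Set
MexEquation S T = ∀ n → T n ⇔ (¬ S n × (∀ {j} → j < n → ¬ T j))

IsSingletonMex : (ℕ → Set) → (ℕ → Set) → Set
IsSingletonMex S T = ∃[ m ] (IsMex S m × (∀ n → T n ⇔ n ≡ m))

mex-or-prefix : ∀ {S} → (∀ k → Dec (S k)) → ∀ n → ∃[ m ] IsMex S m ⊎ (∀ k → k < n → S k)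
mex-or-prefix S? zero = inj₂ (λ _ ())
mex-or-prefix S? (suc n) with mex-or-prefix S? n
... | inj₁ mex = inj₁ mex
... | inj₂ below with S? n
...   | no ¬Sn = inj₁ (n , ¬Sn , below)
...   | yes Sn = inj₂ λ k k<1+n → [ below k , (λ { refl → Sn }) ]′ (m<1+n⇒m<n∨m≡n k<1+n)

mex-exists : ∀ {S} → (∀ k → Dec (S k)) → Bounded S → ∃[ m ] IsMex S m
mex-exists S? (B , bound) with mex-or-prefix S? B
... | inj₁ mex = mex
... | inj₂ below = B , (λ SB → <-irrefl refl (bound B SB)) , below

-- No induction is needed: m ∈ T outright, since every j < m lies in S and hence not in T.
mexEquation⇒singleton : ∀ {S T m} → IsMex S m → MexEquation S T → ∀ n → T n ⇔ n ≡ m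
mexEquation⇒singleton {T = T} {m} (¬Sm , below) equation n = mk⇔ T⇒≡m (λ { refl → Tm })
  where
  Tm : T m
  Tm = from (equation m) (¬Sm , λ {j} j<m Tj → proj₁ (to (equation j) Tj) (below j j<m))

  T⇒≡m : T n → n ≡ m
  T⇒≡m Tn with to (equation n) Tn | <-cmp n m
  ... | ¬Sn , _  | tri< n<m _ _ = contradiction (below n n<m) ¬Sn
  ... | _        | tri≈ _ n≡m _ = n≡m
  ... | _ , ¬T<n | tri> _ _ m<n = contradiction Tm (¬T<n m<n)

mexEquation⇒isSingletonMex : ∀ {S T} → (∀ k → Dec (S k)) → Bounded S → MexEquation S T → IsSingletonMex S T
mexEquation⇒isSingletonMex S? bounded equation =
  let m , mex = mex-exists S? bounded in m , mex , mexEquation⇒singleton mex equation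

isSingletonMex⇒bounded : ∀ {S T} → IsSingletonMex S T → Bounded T
isSingletonMex⇒bounded (m , _ , T⇔≡m) = suc m , λ n Tn → s≤s (≤-reflexive (to (T⇔≡m n) Tn))

×-bounded : ∀ {A : Set} {T} → Dec A → (A → Bounded T) → Bounded (λ k → A × T k)
×-bounded (yes a) bounded = let B , bound = bounded a in B , λ k (_ , Tk) → bound k Tk
×-bounded (no ¬a) _       = 0 , λ k (a , _) → contradiction a ¬a

⋃ : {A : Set} → List A → (A → ℕ → Set) → ℕ → Set
⋃ xs P k = ∃[ x ] (x ∈ xs × P x k)

⋃? : ∀ {A} (xs : List A) {P} → (∀ x k → Dec (P x k)) → ∀ k → Dec (⋃ xs P k)
⋃? xs P? k = map′ find (λ (_ , x∈xs , p) → lose x∈xs p) (any? (λ x → P? x k) xs)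

⋃-bounded : ∀ {A} (xs : List A) {P} → All (λ x → Bounded (P x)) xs → Bounded (⋃ xs P)
⋃-bounded []       []                 = 0 , λ { _ (_ , () , _) }
⋃-bounded (x ∷ xs) {P} ((B , bound) ∷ bounds) = B ⊔ B′ , bound′
  where
  B′ = proj₁ (⋃-bounded xs bounds)

  bound′ : ∀ k → ⋃ (x ∷ xs) P k → k < B ⊔ B′
  bound′ k (_ , here refl , p) = <-≤-trans (bound k p) (m≤m⊔n B B′)
  bound′ k (y , there y∈xs , p) = <-≤-trans (proj₂ (⋃-bounded xs bounds) k (y , y∈xs , p)) (m≤n⊔m B B′)

Game-ind : (P : Game → Set) → (∀ Gs g → All P Gs → P (mk Gs g)) → ∀ G → P G
Game-ind P step (mk Gs g) = step Gs g (all Gs)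
  where
  all : ∀ Gs → All P Gs
  all []       = []
  all (G ∷ Gs) = Game-ind P step G ∷ all Gs

_≟𝒫 : ∀ r → Dec (r ≡ 𝒫)
𝒩 ≟𝒫 = no λ ()
𝒫 ≟𝒫 = yes refl

step≡𝒫⇔ : ∀ r s → step r s ≡ 𝒫 ⇔ (¬ r ≡ 𝒫 × s ≡ 𝒫)
step≡𝒫⇔ 𝒫 s = mk⇔ (λ ()) (λ (r≢𝒫 , _) → contradiction refl r≢𝒫)
step≡𝒫⇔ 𝒩 s = mk⇔ ((λ ()) ,_) proj₂

someP≡𝒫⇔ : ∀ Gs → someP Gs ≡ 𝒫 ⇔ All (λ G → ¬ o G ≡ 𝒫) Gs
someP≡𝒫⇔ []       = mk⇔ (λ _ → []) (λ _ → refl)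
someP≡𝒫⇔ (G ∷ Gs) =
  ⇔-trans (step≡𝒫⇔ (o G) (someP Gs)) (⇔-trans (⇔-refl ×-⇔ someP≡𝒫⇔ Gs) (mk⇔ (uncurry _∷_) All.uncons))

o-active≡𝒫⇔ : ∀ {G} → activeness G ≡ true → o G ≡ 𝒫 ⇔ All (λ G′ → ¬ o G′ ≡ 𝒫) (options G)
o-active≡𝒫⇔ {mk Gs true} refl = someP≡𝒫⇔ Gs

leftMoves≡map : ∀ Gs H → leftMoves Gs H ≡ map (_⊕ H) Gs
leftMoves≡map []       H = refl
leftMoves≡map (G ∷ Gs) H = cong (G ⊕ H ∷_) (leftMoves≡map Gs H)

rightMoves≡map : ∀ G Hs → rightMoves G Hs ≡ map (G ⊕_) Hs
rightMoves≡map G []       = refl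
rightMoves≡map G (H ∷ Hs) = cong (G ⊕ H ∷_) (rightMoves≡map G Hs)

All-options-⊕ : ∀ {Q : Game → Set} G H →
  All Q (options (G ⊕ H)) ⇔ (All (λ G′ → Q (G′ ⊕ H)) (options G) × All (λ H′ → Q (G ⊕ H′)) (options H))
All-options-⊕ (mk Gs g) (mk Hs h)
  rewrite leftMoves≡map Gs (mk Hs h) | rightMoves≡map (mk Gs g) Hs =
  ⇔-trans (⇔-sym (↔⇒⇔ ++↔)) (mk⇔ map⁻ map⁺ ×-⇔ mk⇔ map⁻ map⁺)

starOpts≡applyUpTo : ∀ γ n → starOpts γ n ≡ applyUpTo (star γ) n
starOpts≡applyUpTo γ zero    = refl
starOpts≡applyUpTo γ (suc n) =
  trans (cong (_∷ʳ star γ n) (starOpts≡applyUpTo γ n)) (applyUpTo-∷ʳ (star γ) n)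

All-starOpts : ∀ {Q : Game → Set} γ n → All Q (starOpts γ n) ⇔ (∀ {j} → j < n → Q (star γ j))
All-starOpts γ n rewrite starOpts≡applyUpTo γ n = mk⇔ (applyUpTo⁻ (star γ) n) (applyUpTo⁺₁ (star γ) n)

𝒢-active⇔ : ∀ γ Gs g n → g ∨ γ n ≡ true →
  𝒢 γ (mk Gs g) n ⇔ (All (λ G′ → ¬ 𝒢 γ G′ n) Gs × (∀ {j} → j < n → ¬ 𝒢 γ (mk Gs g) j))
𝒢-active⇔ γ Gs g n active =
  ⇔-trans (o-active≡𝒫⇔ {mk Gs g ⊕ star γ n} active)
    (⇔-trans (All-options-⊕ (mk Gs g) (star γ n)) (⇔-refl ×-⇔ All-starOpts γ n))

𝒢? : ∀ γ G k → Dec (𝒢 γ G k)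
𝒢? γ G k = o (G ⊕ star γ k) ≟𝒫

𝒢-active≡singletonMex : ∀ γ Gs g {P : Game → ℕ → Set} → (∀ n → g ∨ γ n ≡ true) →
  (∀ G k → Dec (P G k)) → All (λ G → Bounded (P G)) Gs →
  (∀ {G} → G ∈ Gs → ∀ n → 𝒢 γ G n ⇔ P G n) →
  IsSingletonMex (⋃ Gs P) (𝒢 γ (mk Gs g))
𝒢-active≡singletonMex γ Gs g {P} active P? bounded 𝒢⇔P =
  mexEquation⇒isSingletonMex (⋃? Gs P?) (⋃-bounded Gs bounded) equation
  where
  options-𝒩⇔ : ∀ n → All (λ G → ¬ 𝒢 γ G n) Gs ⇔ (¬ ⋃ Gs P n)
  options-𝒩⇔ n = mk⇔
    (λ all (G , G∈Gs , p) → All.lookup all G∈Gs (from (𝒢⇔P G∈Gs n) p))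
    (λ ¬⋃ → All.tabulate λ G∈Gs 𝒢Gn → ¬⋃ (_ , G∈Gs , to (𝒢⇔P G∈Gs n) 𝒢Gn))

  equation : MexEquation (⋃ Gs P) (𝒢 γ (mk Gs g))
  equation n = ⇔-trans (𝒢-active⇔ γ Gs g n (active n)) (options-𝒩⇔ n ×-⇔ ⇔-refl)

𝒢𝟏≡singletonMex : ∀ G → IsSingletonMex (UnionOpts1 G) (𝒢 𝟏 G)
𝒢𝟏≡singletonMex = Game-ind (λ G → IsSingletonMex (UnionOpts1 G) (𝒢 𝟏 G)) λ Gs g ih →
  𝒢-active≡singletonMex 𝟏 Gs g (λ _ → ∨-zeroʳ g) (𝒢? 𝟏)
    (All.map isSingletonMex⇒bounded ih) (λ _ _ → ⇔-refl)

allActive-∃0⊎∀1 : ∀ Gs → allActive Gs ≡ t1∃0 ⊎ allActive Gs ≡ t1∀1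
allActive-∃0⊎∀1 []                 = inj₂ refl
allActive-∃0⊎∀1 (mk _ false ∷ Gs) = inj₁ refl
allActive-∃0⊎∀1 (mk _ true ∷ Gs)  = allActive-∃0⊎∀1 Gs

allActive≡t1∃0⇒inactive∈ : ∀ Gs → allActive Gs ≡ t1∃0 → ∃[ Hs ] (mk Hs false ∈ Gs)
allActive≡t1∃0⇒inactive∈ (mk Hs false ∷ Gs) _ = Hs , here refl
allActive≡t1∃0⇒inactive∈ (mk _ true ∷ Gs)   τ =
  let Hs , inactive∈Gs = allActive≡t1∃0⇒inactive∈ Gs τ in Hs , there inactive∈Gs

allActive≡t1∀1⇒All-active : ∀ Gs → allActive Gs ≡ t1∀1 → All (λ G → activeness G ≡ true) Gs
allActive≡t1∀1⇒All-active []                _ = []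
allActive≡t1∀1⇒All-active (mk _ true ∷ Gs) τ = refl ∷ allActive≡t1∀1⇒All-active Gs τ

_≟t1∀1 : ∀ t → Dec (t ≡ t1∀1)
t0   ≟t1∀1 = no λ ()
t1∃0 ≟t1∀1 = no λ ()
t1∀1 ≟t1∀1 = yes refl

𝒢𝟎-t0 : ∀ G → type G ≡ t0 → ∀ n → 𝒢 𝟎 G n
𝒢𝟎-t0 (mk Gs false) _ n = refl
𝒢𝟎-t0 (mk Gs true)  τ n with allActive-∃0⊎∀1 Gs
... | inj₁ τ′ = contradiction (trans (sym τ′) τ) λ ()
... | inj₂ τ′ = contradiction (trans (sym τ′) τ) λ ()

-- The inactive option stays inactive in the sum with ∗^𝟎 n, so it is a 𝒫-position.
𝒢𝟎-t1∃0 : ∀ G → type G ≡ t1∃0 → ∀ n → ¬ 𝒢 𝟎 G n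
𝒢𝟎-t1∃0 (mk Gs true) τ n 𝒢Gn =
  let _ , inactive∈Gs = allActive≡t1∃0⇒inactive∈ Gs τ
  in All.lookup (proj₁ (to (𝒢-active⇔ 𝟎 Gs true n refl) 𝒢Gn)) inactive∈Gs refl

𝒢𝟎-active⇔ : ∀ G n → activeness G ≡ true → 𝒢 𝟎 G n ⇔ (type G ≡ t1∀1 × 𝒢 𝟎 G n)
𝒢𝟎-active⇔ (mk Gs true) n refl with allActive-∃0⊎∀1 Gs
... | inj₁ τ = mk⇔ (λ 𝒢Gn → contradiction 𝒢Gn (𝒢𝟎-t1∃0 (mk Gs true) τ n)) proj₂
... | inj₂ τ = mk⇔ (τ ,_) proj₂

𝒢𝟎-t1∀1 : ∀ G → type G ≡ t1∀1 → IsSingletonMex (UnionOpts0 G) (𝒢 𝟎 G)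
𝒢𝟎-t1∀1 = Game-ind Claim claim-mk
  where
  Claim : Game → Set
  Claim G = type G ≡ t1∀1 → IsSingletonMex (UnionOpts0 G) (𝒢 𝟎 G)

  claim-mk : ∀ Gs g → All Claim Gs → Claim (mk Gs g)
  claim-mk Gs true ih τ =
    𝒢-active≡singletonMex 𝟎 Gs true (λ _ → refl) (λ G k → (type G ≟t1∀1) ×-dec 𝒢? 𝟎 G k)
      (All.map (λ {G} claim → ×-bounded (type G ≟t1∀1) (isSingletonMex⇒bounded ∘′ claim)) ih)
      (λ {G} G∈Gs n → 𝒢𝟎-active⇔ G n (All.lookup (allActive≡t1∀1⇒All-active Gs τ) G∈Gs))

theorem3p16 : (G : Game) →
    (∃[ m ] (IsMex (UnionOpts1 G) m × (∀ n → 𝒢 𝟏 G n ⇔ n ≡ m)))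
    × ((type G ≡ t0 → ∀ n → 𝒢 𝟎 G n)
    × ((type G ≡ t1∃0 → ∀ n → ¬ 𝒢 𝟎 G n)
    × (type G ≡ t1∀1 → ∃[ m ] (IsMex (UnionOpts0 G) m × (∀ n → 𝒢 𝟎 G n ⇔ n ≡ m)))))
theorem3p16 G = 𝒢𝟏≡singletonMex G , 𝒢𝟎-t0 G , 𝒢𝟎-t1∃0 G , 𝒢𝟎-t1∀1 G
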